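{- Let $G$ be a connected cograph whose edge connectivity is $k$, and let $X$ be the set of vertices of degree $k$ in $G$. Then every set $E_{ca}$ of non-edges of $G$ such that $G\cup E_{ca}$ has edge connectivity $k+1$ satisfies $|E_{ca}|\ge\rho(\overline{G}[X])$.
   Context: A cograph is a finite simple $P_4$-free graph. The edge connectivity of a connected graph is the minimum number of edges whose removal disconnects it. $\overline{G}$ is the complement of $G$ and $\overline{G}[X]$ its subgraph induced on $X$. For a graph $H$ without isolated vertices, $\rho(H)$ is the minimum cardinality of an edge cover (a set of edges such that every vertex is incident to at least one of them). For a general graph $H$ with connected components $H_1,\dots,H_r$, $\rho(H)=\sum_i\rho(H_i)$, where $\rho(H_i)=1$ if $H_i$ consists of a single vertex. -}

module Defs where

open import Data.Nat using (ℕ; zero; suc; _+_; _≤_; _<ᵇ_; _≡ᵇ_)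
open import Data.Fin using (Fin; toℕ)
open import Data.Bool using (Bool; true; false; _∧_; _∨_; not; if_then_else_)
open import Data.Product using (Σ; ∃; _×_; _,_)
open import Relation.Binary.PropositionalEquality using (_≡_)
open import Relation.Nullary using (¬_)

Rel : ℕ → Set
Rel n = Fin n → Fin n → Bool

IsGraph : ∀ {n} → Rel n → Set
IsGraph {n} G = (∀ u v → G u v ≡ G v u) × (∀ v → G v v ≡ false)

count : ∀ {n} → (Fin n → Bool) → ℕ
count {zero} p = 0
count {suc n} p = (if p Fin.zero then 1 else 0) + count (λ i → p (Fin.suc i))

allB : ∀ {n} → (Fin n → Bool) → Bool
allB {zero} p = true
allB {suc n} p = p Fin.zero ∧ allB (λ i → p (Fin.suc i))

numEdges : ∀ {n} → Rel n → ℕ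
numEdges {n} G = sumF (λ i → count (λ j → (toℕ i <ᵇ toℕ j) ∧ G i j))
  where
  sumF : ∀ {m} → (Fin m → ℕ) → ℕ
  sumF {zero} f = 0
  sumF {suc m} f = f Fin.zero + sumF (λ i → f (Fin.suc i))

deg : ∀ {n} → Rel n → Fin n → ℕ
deg G u = count (λ v → G u v)

_⊆ᴱ_ : ∀ {n} → Rel n → Rel n → Set
F ⊆ᴱ G = ∀ u v → F u v ≡ true → G u v ≡ true

_∪ᴱ_ : ∀ {n} → Rel n → Rel n → Rel n
(G ∪ᴱ H) u v = G u v ∨ H u v

_−ᴱ_ : ∀ {n} → Rel n → Rel n → Rel n
(G −ᴱ F) u v = G u v ∧ not (F u v)

data Reach {n} (G : Rel n) : Fin n → Fin n → Set where
  here : ∀ {u} → Reach G u u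
  step : ∀ {u w v} → G u w ≡ true → Reach G w v → Reach G u v

Connected : ∀ {n} → Rel n → Set
Connected {n} G = ∀ (u v : Fin n) → Reach G u v

Cograph : ∀ {n} → Rel n → Set
Cograph {n} G = ∀ (a b c d : Fin n) →
  ¬ (G a b ≡ true × G b c ≡ true × G c d ≡ true ×
     G a c ≡ false × G b d ≡ false × G a d ≡ false)

EdgeConnectivity : ∀ {n} → Rel n → ℕ → Set
EdgeConnectivity {n} G k =
  Connected G ×
  (Σ (Rel n) λ F → IsGraph F × F ⊆ᴱ G × ¬ Connected (G −ᴱ F) × numEdges F ≡ k) ×
  (∀ (F : Rel n) → IsGraph F → F ⊆ᴱ G → ¬ Connected (G −ᴱ F) → k ≤ numEdges F)

-- complement of G induced on the vertex subset S (as a graph on Fin n whose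
-- edges lie inside S; vertices outside S are not vertices of this graph)
coInduced : ∀ {n} → Rel n → (Fin n → Bool) → Rel n
coInduced G S u v = S u ∧ S v ∧ not (G u v) ∧ not (G v u) ∧ not (toℕ u ≡ᵇ toℕ v)

isolatedB : ∀ {n} → Rel n → (Fin n → Bool) → Fin n → Bool
isolatedB H S v = S v ∧ allB (λ u → not (H u v))

-- F ⊆ E(H) is an edge cover of the non-trivial components of H,
-- i.e. covers every non-isolated vertex of H
CoversNonIsolated : ∀ {n} → Rel n → (Fin n → Bool) → Rel n → Set
CoversNonIsolated {n} H S F =
  IsGraph F × F ⊆ᴱ H ×
  (∀ (v : Fin n) → S v ≡ true → (∃ λ u → H u v ≡ true) → ∃ λ u → F u v ≡ true)

-- ρ(H) = r : sum over components, min edge cover for nontrivial components,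
-- 1 for each single-vertex component
Rho : ∀ {n} → Rel n → (Fin n → Bool) → ℕ → Set
Rho {n} H S r =
  (Σ (Rel n) λ F → CoversNonIsolated H S F × numEdges F + count (isolatedB H S) ≡ r) ×
  (∀ (F : Rel n) → CoversNonIsolated H S F → r ≤ numEdges F + count (isolatedB H S))

-- A vertex v of degree k in G must receive an edge of Eca: otherwise deleting the
-- k edges of G at v isolates v in G ∪ Eca, whose edge connectivity is k + 1.
-- The edges of Eca inside X are edges of the complement of G on X; adding one
-- edge for each non-isolated vertex they miss yields an edge cover, so ρ is at
-- most the number of Eca-edges inside X plus the number of vertices of X that
-- they miss. Each missed vertex has an Eca-edge leaving X, and these edges are
-- distinct from each other and from those inside X.

module Submission where

open import Defs
open import Data.Nat using (ℕ; suc; _≤_; _≡ᵇ_)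
open import Data.Fin using (Fin)
open import Data.Bool using (Bool; true; false)
open import Relation.Binary.PropositionalEquality using (_≡_)

open import Data.Nat using (zero; _+_; _*_; _<ᵇ_; z≤n; s≤s)
open import Data.Nat.Properties
  using (≤-refl; ≤-trans; ≤-reflexive; +-mono-≤; +-monoˡ-≤; +-monoʳ-≤; +-assoc; +-cancelˡ-≤; +-comm; +-identityʳ; m≤n+m;
         *-cancelˡ-≤; *-distribˡ-+; +-0-commutativeMonoid; module ≤-Reasoning)
open import Data.Fin using (toℕ) renaming (zero to fzero; suc to fsuc)
open import Data.Fin.Properties using (toℕ-injective; suc-injective; any?)
open import Data.Bool using (_∧_; _∨_; not; if_then_else_)
open import Data.Bool.Properties using (∨-comm; not-injective; ∧-zeroʳ; ∧-identityʳ; _≟_)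
open import Data.Product using (Σ; ∃; _×_; _,_; proj₁; proj₂)
open import Data.Sum using (_⊎_; inj₁; inj₂)
open import Data.Empty using (⊥-elim)
open import Function using (case_of_; flip; _∘_)
open import Relation.Nullary using (¬_; yes; no)
open import Relation.Binary.PropositionalEquality using (refl; sym; trans; cong; cong₂; subst; _≢_; module ≡-Reasoning)
open import Algebra.Properties.CommutativeMonoid.Sum +-0-commutativeMonoid
  using (sum; sum-cong-≗; ∑-comm; ∑-distrib-+)

t≢f : true ≢ false
t≢f ()

∧-true⁻ : ∀ {a b} → a ∧ b ≡ true → a ≡ true × b ≡ true
∧-true⁻ {true} b≡t = refl , b≡t

∧-true⁺ : ∀ {a b} → a ≡ true → b ≡ true → a ∧ b ≡ true
∧-true⁺ refl b≡t = b≡t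

∨-true⁻ : ∀ {a b} → a ∨ b ≡ true → a ≡ true ⊎ b ≡ true
∨-true⁻ {true} _ = inj₁ refl
∨-true⁻ {false} b≡t = inj₂ b≡t

∨-trueˡ : ∀ {a b} → a ≡ true → a ∨ b ≡ true
∨-trueˡ refl = refl

∨-trueʳ : ∀ {a b} → b ≡ true → a ∨ b ≡ true
∨-trueʳ {true} _ = refl
∨-trueʳ {false} b≡t = b≡t

≢true⇒false : ∀ {b} → b ≢ true → b ≡ false
≢true⇒false {true} b≢t = ⊥-elim (b≢t refl)
≢true⇒false {false} _ = refl

≡ᵇ-refl : ∀ m → (m ≡ᵇ m) ≡ true
≡ᵇ-refl zero = refl
≡ᵇ-refl (suc m) = ≡ᵇ-refl m

≡ᵇ-sym : ∀ m n → (m ≡ᵇ n) ≡ (n ≡ᵇ m)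
≡ᵇ-sym zero zero = refl
≡ᵇ-sym zero (suc n) = refl
≡ᵇ-sym (suc m) zero = refl
≡ᵇ-sym (suc m) (suc n) = ≡ᵇ-sym m n

≡ᵇ-true⇒≡ : ∀ m n → (m ≡ᵇ n) ≡ true → m ≡ n
≡ᵇ-true⇒≡ zero zero _ = refl
≡ᵇ-true⇒≡ (suc m) (suc n) e = cong suc (≡ᵇ-true⇒≡ m n e)

_==_ : ∀ {n} → Fin n → Fin n → Bool
u == v = toℕ u ≡ᵇ toℕ v

==⇒≡ : ∀ {n} {u v : Fin n} → u == v ≡ true → u ≡ v
==⇒≡ e = toℕ-injective (≡ᵇ-true⇒≡ _ _ e)

allB-true⁻ : ∀ {n} {p : Fin n → Bool} → allB p ≡ true → ∀ i → p i ≡ true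
allB-true⁻ {suc n} {p} all fzero = proj₁ (∧-true⁻ all)
allB-true⁻ {suc n} {p} all (fsuc i) = allB-true⁻ (proj₂ (∧-true⁻ {p fzero} all)) i

allB-false⁻ : ∀ {n} {p : Fin n → Bool} → allB p ≡ false → ∃ λ i → p i ≡ false
allB-false⁻ {suc n} {p} notAll with p fzero in e
... | false = fzero , e
... | true with allB-false⁻ {p = λ i → p (fsuc i)} notAll
...   | i , pi = fsuc i , pi

ind : Bool → ℕ
ind b = if b then 1 else 0

ind≤1 : ∀ b → ind b ≤ 1
ind≤1 true = ≤-refl
ind≤1 false = z≤n

ind-mono : ∀ {a b} → (a ≡ true → b ≡ true) → ind a ≤ ind b
ind-mono {true} a⇒b rewrite a⇒b refl = ≤-refl
ind-mono {false} _ = z≤n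

count≡∑ind : ∀ {n} (p : Fin n → Bool) → count p ≡ sum (λ i → ind (p i))
count≡∑ind {zero} p = refl
count≡∑ind {suc n} p = cong (ind (p fzero) +_) (count≡∑ind (λ i → p (fsuc i)))

sum-mono-≤ : ∀ {n} {f g : Fin n → ℕ} → (∀ i → f i ≤ g i) → sum f ≤ sum g
sum-mono-≤ {zero} _ = z≤n
sum-mono-≤ {suc n} f≤g = +-mono-≤ (f≤g fzero) (sum-mono-≤ (λ i → f≤g (fsuc i)))

count-+-≤ : ∀ {n} (p q r : Fin n → Bool) →
  (∀ i → ind (p i) + ind (q i) ≤ ind (r i)) → count p + count q ≤ count r
count-+-≤ p q r pointwise = begin
  count p + count q
    ≡⟨ cong₂ _+_ (count≡∑ind p) (count≡∑ind q) ⟩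
  sum (λ i → ind (p i)) + sum (λ i → ind (q i))
    ≡⟨ sym (∑-distrib-+ (λ i → ind (p i)) (λ i → ind (q i))) ⟩
  sum (λ i → ind (p i) + ind (q i))
    ≤⟨ sum-mono-≤ pointwise ⟩
  sum (λ i → ind (r i))
    ≡⟨ sym (count≡∑ind r) ⟩
  count r ∎
  where open ≤-Reasoning

count-mono : ∀ {n} {p q : Fin n → Bool} → (∀ i → p i ≡ true → q i ≡ true) → count p ≤ count q
count-mono {p = p} {q} p⇒q = begin
  count p                ≡⟨ count≡∑ind p ⟩
  sum (λ i → ind (p i))  ≤⟨ sum-mono-≤ (λ i → ind-mono (p⇒q i)) ⟩
  sum (λ i → ind (q i))  ≡⟨ sym (count≡∑ind q) ⟩
  count q                ∎
  where open ≤-Reasoning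

count-∨-≤ : ∀ {n} (p q : Fin n → Bool) → count (λ i → p i ∨ q i) ≤ count p + count q
count-∨-≤ p q = begin
  count (λ i → p i ∨ q i)                       ≡⟨ count≡∑ind (λ i → p i ∨ q i) ⟩
  sum (λ i → ind (p i ∨ q i))                   ≤⟨ sum-mono-≤ (λ i → ind-∨ (p i) (q i)) ⟩
  sum (λ i → ind (p i) + ind (q i))             ≡⟨ ∑-distrib-+ (λ i → ind (p i)) (λ i → ind (q i)) ⟩
  sum (λ i → ind (p i)) + sum (λ i → ind (q i)) ≡⟨ sym (cong₂ _+_ (count≡∑ind p) (count≡∑ind q)) ⟩
  count p + count q                             ∎
  where
  open ≤-Reasoning
  ind-∨ : ∀ a b → ind (a ∨ b) ≤ ind a + ind b
  ind-∨ true _ = s≤s z≤n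
  ind-∨ false _ = ≤-refl

count-none : ∀ {n} {q : Fin n → Bool} → (∀ i → q i ≢ true) → count q ≡ 0
count-none {zero} _ = refl
count-none {suc n} {q} none rewrite ≢true⇒false (none fzero) = count-none (λ i → none (fsuc i))

count-concentrated : ∀ {n} {q : Fin n → Bool} (c : Fin n) →
  (∀ i → q i ≡ true → i ≡ c) → count q ≤ ind (q c)
count-concentrated {suc n} {q} fzero at-c =
  ≤-reflexive (trans (cong (ind (q fzero) +_) (count-none (λ i e → case at-c (fsuc i) e of λ ()))) (+-identityʳ _))
count-concentrated {suc n} {q} (fsuc c) at-c
  rewrite ≢true⇒false {q fzero} (λ e → case at-c fzero e of λ ()) =
  count-concentrated c (λ i e → suc-injective (at-c (fsuc i) e))

count-witness⁺ : ∀ {n} {q : Fin n → Bool} (i : Fin n) → q i ≡ true → 1 ≤ count q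
count-witness⁺ fzero qi rewrite qi = s≤s z≤n
count-witness⁺ {suc n} {q} (fsuc i) qi = ≤-trans (count-witness⁺ i qi) (m≤n+m _ (ind (q fzero)))

count-witness⁻ : ∀ {n} {q : Fin n → Bool} → 1 ≤ count q → ∃ λ i → q i ≡ true
count-witness⁻ {suc n} {q} pos with q fzero in e
... | true = fzero , e
... | false with count-witness⁻ {q = λ i → q (fsuc i)} pos
...   | i , qi = fsuc i , qi

ind-≤ : ∀ {b m} → (b ≡ true → 1 ≤ m) → ind b ≤ m
ind-≤ {true} pos = pos refl
ind-≤ {false} _ = z≤n

count-≤-sum : ∀ {n} (p : Fin n → Bool) (f : Fin n → ℕ) → (∀ i → p i ≡ true → 1 ≤ f i) → count p ≤ sum f
count-≤-sum p f pos = ≤-trans (≤-reflexive (count≡∑ind p)) (sum-mono-≤ (λ i → ind-≤ (pos i)))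

arcs : ∀ {n} → Rel n → ℕ
arcs R = sum (λ i → count (R i))

arcs≡∑∑ind : ∀ {n} (R : Rel n) → arcs R ≡ sum (λ i → sum (λ j → ind (R i j)))
arcs≡∑∑ind R = sum-cong-≗ (count≡∑ind ∘ R)

arcs-flip : ∀ {n} (R : Rel n) → arcs R ≡ arcs (flip R)
arcs-flip R = begin
  arcs R                                  ≡⟨ arcs≡∑∑ind R ⟩
  sum (λ i → sum (λ j → ind (R i j)))     ≡⟨ ∑-comm (λ i j → ind (R i j)) ⟩
  sum (λ j → sum (λ i → ind (R i j)))     ≡⟨ sym (arcs≡∑∑ind (flip R)) ⟩
  arcs (flip R)                           ∎
  where open ≡-Reasoning

arcs-+ : ∀ {n} (R S : Rel n) → arcs R + arcs S ≡ sum (λ i → sum (λ j → ind (R i j) + ind (S i j)))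
arcs-+ R S = begin
  arcs R + arcs S
    ≡⟨ cong₂ _+_ (arcs≡∑∑ind R) (arcs≡∑∑ind S) ⟩
  sum (λ i → sum (λ j → ind (R i j))) + sum (λ i → sum (λ j → ind (S i j)))
    ≡⟨ sym (∑-distrib-+ (λ i → sum (λ j → ind (R i j))) (λ i → sum (λ j → ind (S i j)))) ⟩
  sum (λ i → sum (λ j → ind (R i j)) + sum (λ j → ind (S i j)))
    ≡⟨ sum-cong-≗ (λ i → sym (∑-distrib-+ (λ j → ind (R i j)) (λ j → ind (S i j)))) ⟩
  sum (λ i → sum (λ j → ind (R i j) + ind (S i j))) ∎
  where open ≡-Reasoning

arcs-split : ∀ {n} (R S T : Rel n) → (∀ i j → ind (R i j) ≡ ind (S i j) + ind (T i j)) →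
  arcs R ≡ arcs S + arcs T
arcs-split R S T pointwise =
  trans (arcs≡∑∑ind R) (trans (sum-cong-≗ (λ i → sum-cong-≗ (pointwise i))) (sym (arcs-+ S T)))

arcs-+-≤ : ∀ {n} (R S T : Rel n) → (∀ i j → ind (R i j) + ind (S i j) ≤ ind (T i j)) →
  arcs R + arcs S ≤ arcs T
arcs-+-≤ R S T pointwise =
  ≤-trans (≤-reflexive (arcs-+ R S))
    (≤-trans (sum-mono-≤ (λ i → sum-mono-≤ (pointwise i))) (≤-reflexive (sym (arcs≡∑∑ind T))))

arcs-mono : ∀ {n} {R S : Rel n} → R ⊆ᴱ S → arcs R ≤ arcs S
arcs-mono R⊆S = sum-mono-≤ (λ i → count-mono (R⊆S i))

arcs-∪-≤ : ∀ {n} (R S : Rel n) → arcs (R ∪ᴱ S) ≤ arcs R + arcs S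
arcs-∪-≤ R S = begin
  arcs (R ∪ᴱ S)                           ≤⟨ sum-mono-≤ (λ i → count-∨-≤ (R i) (S i)) ⟩
  sum (λ i → count (R i) + count (S i))   ≡⟨ ∑-distrib-+ (λ i → count (R i)) (λ i → count (S i)) ⟩
  arcs R + arcs S                         ∎
  where open ≤-Reasoning

count-≤-arcs : ∀ {n} (p : Fin n → Bool) (R : Rel n) →
  (∀ i → p i ≡ true → ∃ λ j → R i j ≡ true) → count p ≤ arcs R
count-≤-arcs p R out = count-≤-sum p (λ i → count (R i)) (λ i pi → let (j , Rij) = out i pi in count-witness⁺ j Rij)

upper : ∀ {n} → Rel n → Rel n
upper R i j = (toℕ i <ᵇ toℕ j) ∧ R i j

numEdges≡arcs-upper : ∀ {n} (R : Rel n) → numEdges R ≡ arcs (upper R)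
numEdges≡arcs-upper {zero} R = refl
numEdges≡arcs-upper {suc n} R =
  cong (count (upper R fzero) +_) (numEdges≡arcs-upper (λ i j → R (fsuc i) (fsuc j)))

<ᵇ-trichotomy : ∀ m n → m ≢ n → ind (m <ᵇ n) + ind (n <ᵇ m) ≡ 1
<ᵇ-trichotomy zero zero m≢n = ⊥-elim (m≢n refl)
<ᵇ-trichotomy zero (suc n) _ = refl
<ᵇ-trichotomy (suc m) zero _ = refl
<ᵇ-trichotomy (suc m) (suc n) m≢n = <ᵇ-trichotomy m n (m≢n ∘ cong suc)

arcs≡2*numEdges : ∀ {n} (R : Rel n) → IsGraph R → arcs R ≡ 2 * numEdges R
arcs≡2*numEdges R (R-sym , R-irr) = begin
  arcs R                            ≡⟨ arcs-split R (upper R) (flip (upper R)) split ⟩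
  arcs (upper R) + arcs (flip (upper R)) ≡⟨ cong (arcs (upper R) +_) (sym (arcs-flip (upper R))) ⟩
  arcs (upper R) + arcs (upper R)   ≡⟨ cong (λ m → m + m) (sym (numEdges≡arcs-upper R)) ⟩
  numEdges R + numEdges R           ≡⟨ cong (numEdges R +_) (sym (+-identityʳ (numEdges R))) ⟩
  2 * numEdges R                    ∎
  where
  open ≡-Reasoning
  split : ∀ i j → ind (R i j) ≡ ind (upper R i j) + ind (upper R j i)
  split i j with R i j in e
  ... | false rewrite ∧-zeroʳ (toℕ i <ᵇ toℕ j) | R-sym j i | e | ∧-zeroʳ (toℕ j <ᵇ toℕ i) = refl
  ... | true rewrite ∧-identityʳ (toℕ i <ᵇ toℕ j) | R-sym j i | e | ∧-identityʳ (toℕ j <ᵇ toℕ i) =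
    sym (<ᵇ-trichotomy (toℕ i) (toℕ j) (λ i≡j → t≢f (trans (sym e) (subst (λ v → R i v ≡ false) (toℕ-injective i≡j) (R-irr i)))))

-- Edge connectivity is at most the minimum degree

reach-from-isolated : ∀ {n} {K : Rel n} {v u} → (∀ w → K v w ≡ false) → Reach K v u → u ≡ v
reach-from-isolated _ here = refl
reach-from-isolated v-isolated (step {w = w} e _) = ⊥-elim (t≢f (trans (sym e) (v-isolated w)))

-- The disconnecting set witnessing the edge connectivity of K shows that there are at least two vertices.
isolated⇒¬connected : ∀ {n} {K L : Rel n} {c} → EdgeConnectivity K c →
  (v : Fin n) → (∀ w → L v w ≡ false) → ¬ Connected L
isolated⇒¬connected (_ , (_ , _ , _ , F-disconnects , _) , _) v v-isolated L-connected =
  F-disconnects (λ a b → subst (Reach _ a) (trans (collapse a) (sym (collapse b))) here)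
  where
  collapse : ∀ u → u ≡ v
  collapse u = reach-from-isolated v-isolated (L-connected v u)

star : ∀ {n} → Rel n → Fin n → Rel n
star K v u w = K u w ∧ (u == v ∨ w == v)

star-isGraph : ∀ {n} {K : Rel n} (v : Fin n) → IsGraph K → IsGraph (star K v)
star-isGraph v (K-sym , K-irr) =
  (λ u w → cong₂ _∧_ (K-sym u w) (∨-comm (u == v) (w == v))) ,
  (λ u → cong (_∧ (u == v ∨ u == v)) (K-irr u))

star-⊆ : ∀ {n} (K : Rel n) (v : Fin n) → star K v ⊆ᴱ K
star-⊆ K v u w e = proj₁ (∧-true⁻ e)

star-isolates : ∀ {n} (K : Rel n) (v : Fin n) → ∀ w → (K −ᴱ star K v) v w ≡ false
star-isolates K v w rewrite ≡ᵇ-refl (toℕ v) with K v w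
... | true = refl
... | false = refl

numEdges-star≤deg : ∀ {n} {K : Rel n} (v : Fin n) → IsGraph K → numEdges (star K v) ≤ deg K v
numEdges-star≤deg {n} {K} v K-graph@(K-sym , _) = *-cancelˡ-≤ 2 (begin
  2 * numEdges (star K v)       ≡⟨ sym (arcs≡2*numEdges (star K v) (star-isGraph v K-graph)) ⟩
  arcs (star K v)               ≤⟨ arcs-mono star⊆A∪Aᵀ ⟩
  arcs (A ∪ᴱ flip A)            ≤⟨ arcs-∪-≤ A (flip A) ⟩
  arcs A + arcs (flip A)        ≡⟨ cong (_+ arcs (flip A)) (arcs-flip A) ⟩
  arcs (flip A) + arcs (flip A) ≤⟨ +-mono-≤ arcs-Aᵀ≤deg arcs-Aᵀ≤deg ⟩
  deg K v + deg K v             ≡⟨ cong (deg K v +_) (sym (+-identityʳ (deg K v))) ⟩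
  2 * deg K v                   ∎)
  where
  open ≤-Reasoning
  A : Rel n
  A u w = (u == v) ∧ K u w
  star⊆A∪Aᵀ : star K v ⊆ᴱ (A ∪ᴱ flip A)
  star⊆A∪Aᵀ u w e with ∧-true⁻ e
  ... | Kuw , ends with ∨-true⁻ ends
  ...   | inj₁ u=v = ∨-trueˡ (∧-true⁺ u=v Kuw)
  ...   | inj₂ w=v = ∨-trueʳ {A u w} (∧-true⁺ w=v (trans (K-sym w u) Kuw))
  arcs-Aᵀ≤deg : arcs (flip A) ≤ deg K v
  arcs-Aᵀ≤deg = begin
    sum (λ w → count (λ u → A u w))  ≤⟨ sum-mono-≤ (λ w → count-concentrated {q = λ u → A u w} v (λ u e → ==⇒≡ (proj₁ (∧-true⁻ e)))) ⟩
    sum (λ w → ind (A v w))          ≡⟨ sum-cong-≗ (λ w → cong (λ b → ind (b ∧ K v w)) (≡ᵇ-refl (toℕ v))) ⟩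
    sum (λ w → ind (K v w))          ≡⟨ sym (count≡∑ind (K v)) ⟩
    deg K v                          ∎

edgeConnectivity≤deg : ∀ {n} {K : Rel n} {c} → IsGraph K → EdgeConnectivity K c → ∀ v → c ≤ deg K v
edgeConnectivity≤deg {K = K} K-graph κ@(_ , _ , minimal) v =
  ≤-trans (minimal (star K v) (star-isGraph v K-graph) (star-⊆ K v) (isolated⇒¬connected κ v (star-isolates K v)))
          (numEdges-star≤deg v K-graph)

∪-isGraph : ∀ {n} {G E : Rel n} → IsGraph G → IsGraph E → IsGraph (G ∪ᴱ E)
∪-isGraph (G-sym , G-irr) (E-sym , E-irr) =
  (λ u v → cong₂ _∨_ (G-sym u v) (E-sym u v)) , (λ v → cong₂ _∨_ (G-irr v) (E-irr v))

new-neighbour : ∀ {n} {G E : Rel n} {k} → IsGraph G → IsGraph E →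
  EdgeConnectivity (G ∪ᴱ E) (suc k) → ∀ v → deg G v ≡ k → ∃ λ u → E v u ≡ true
new-neighbour {G = G} {E} {k} G-graph E-graph κ v deg-v = count-witness⁻ (+-cancelˡ-≤ k 1 (deg E v) (begin
  k + 1               ≡⟨ +-comm k 1 ⟩
  suc k               ≤⟨ edgeConnectivity≤deg (∪-isGraph G-graph E-graph) κ v ⟩
  deg (G ∪ᴱ E) v      ≤⟨ count-∨-≤ (G v) (E v) ⟩
  deg G v + deg E v   ≡⟨ cong (_+ deg E v) deg-v ⟩
  k + deg E v         ∎))
  where open ≤-Reasoning

-- Extending a partial edge cover

isolated-antimono : ∀ {n} {F H : Rel n} {S} v → F ⊆ᴱ H → isolatedB H S v ≡ true → isolatedB F S v ≡ true
isolated-antimono {F = F} v F⊆H iso-H with ∧-true⁻ iso-H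
... | Sv , noH with allB (λ u → not (F u v)) in e
...   | true = ∧-true⁺ Sv refl
...   | false with allB-false⁻ e
...     | u , Fuv = ⊥-elim (t≢f (trans (sym (F⊆H u v (not-injective Fuv))) (not-injective (allB-true⁻ noH u))))

pick : ∀ {n} → (Fin n → Bool) → Fin n → Bool
pick q j with any? (λ i → q i ≟ true)
... | yes (w , _) = j == w
... | no _ = false

pick-sound : ∀ {n} (q : Fin n → Bool) j → pick q j ≡ true → q j ≡ true
pick-sound q j picked with any? (λ i → q i ≟ true)
... | yes (w , qw) rewrite ==⇒≡ {u = j} {w} picked = qw

pick-complete : ∀ {n} (q : Fin n → Bool) i → q i ≡ true → ∃ λ j → pick q j ≡ true
pick-complete q i qi with any? (λ i → q i ≟ true)
... | yes (w , _) = w , ≡ᵇ-refl (toℕ w)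
... | no none = ⊥-elim (none (i , qi))

count-pick≤1 : ∀ {n} (q : Fin n → Bool) → count (pick q) ≤ 1
count-pick≤1 {n} q with any? (λ i → q i ≟ true)
... | yes (w , _) = ≤-trans (count-concentrated w (λ j → ==⇒≡)) (ind≤1 (w == w))
... | no _ = ≤-trans (≤-reflexive (count-none {n} {λ _ → false} (λ _ ()))) z≤n

uncovered : ∀ {n} → Rel n → Rel n → (Fin n → Bool) → Fin n → Bool
uncovered H F₀ S v = isolatedB F₀ S v ∧ not (isolatedB H S v)

count-guarded : ∀ {n} b (q : Fin n → Bool) → count q ≤ 1 → count (λ j → b ∧ q j) ≤ ind b
count-guarded true q count≤1 = count≤1
count-guarded {n} false q _ = ≤-reflexive (count-none {n} {λ _ → false} (λ _ ()))

extend-cover : ∀ {n} {H F₀ : Rel n} (S : Fin n → Bool) → IsGraph H → IsGraph F₀ → F₀ ⊆ᴱ H →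
  Σ (Rel n) λ F → CoversNonIsolated H S F × numEdges F ≤ numEdges F₀ + count (uncovered H F₀ S)
extend-cover {n} {H} {F₀} S (H-sym , H-irr) F₀-graph@(F₀-sym , _) F₀⊆H =
  F , (F-graph , F⊆H , F-covers) , F-size
  where
  A : Rel n
  A u v = uncovered H F₀ S v ∧ pick (λ w → H w v) u
  F : Rel n
  F = F₀ ∪ᴱ (A ∪ᴱ flip A)

  A⊆H : A ⊆ᴱ H
  A⊆H u v e = pick-sound (λ w → H w v) u (proj₂ (∧-true⁻ e))

  F⊆H : F ⊆ᴱ H
  F⊆H u v e with ∨-true⁻ e
  ... | inj₁ F₀uv = F₀⊆H u v F₀uv
  ... | inj₂ Auv∨Avu with ∨-true⁻ Auv∨Avu
  ...   | inj₁ Auv = A⊆H u v Auv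
  ...   | inj₂ Avu = trans (H-sym u v) (A⊆H v u Avu)

  F-graph : IsGraph F
  F-graph = (λ u v → cong₂ _∨_ (F₀-sym u v) (∨-comm (A u v) (A v u))) ,
            (λ v → ≢true⇒false (λ e → t≢f (trans (sym (F⊆H v v e)) (H-irr v))))

  F-covers : ∀ v → S v ≡ true → (∃ λ u → H u v ≡ true) → ∃ λ u → F u v ≡ true
  F-covers v Sv (u , Huv) with isolatedB F₀ S v in iso
  ... | false with allB-false⁻ {p = λ u → not (F₀ u v)} (subst (λ b → b ∧ allB (λ u → not (F₀ u v)) ≡ false) Sv iso)
  ...   | w , F₀wv = w , ∨-trueˡ (not-injective F₀wv)
  F-covers v Sv (u , Huv) | true with pick-complete (λ w → H w v) u Huv
  ...   | w , picked = w , ∨-trueʳ {F₀ w v} (∨-trueˡ (∧-true⁺ (cong not H-nonisolated) picked))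
    where
    H-nonisolated : isolatedB H S v ≡ false
    H-nonisolated = ≢true⇒false (λ e → t≢f (trans (sym Huv) (not-injective (allB-true⁻ (proj₂ (∧-true⁻ e)) u))))

  arcs-Aᵀ≤uncovered : arcs (flip A) ≤ count (uncovered H F₀ S)
  arcs-Aᵀ≤uncovered = begin
    sum (λ v → count (λ u → A u v))         ≤⟨ sum-mono-≤ (λ v → count-guarded {n} (uncovered H F₀ S v) (pick (λ w → H w v)) (count-pick≤1 (λ w → H w v))) ⟩
    sum (λ v → ind (uncovered H F₀ S v))    ≡⟨ sym (count≡∑ind (uncovered H F₀ S)) ⟩
    count (uncovered H F₀ S)                ∎
    where open ≤-Reasoning

  F-size : numEdges F ≤ numEdges F₀ + count (uncovered H F₀ S)
  F-size = *-cancelˡ-≤ 2 (begin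
    2 * numEdges F                              ≡⟨ sym (arcs≡2*numEdges F F-graph) ⟩
    arcs F                                      ≤⟨ arcs-∪-≤ F₀ (A ∪ᴱ flip A) ⟩
    arcs F₀ + arcs (A ∪ᴱ flip A)                ≤⟨ +-monoʳ-≤ (arcs F₀) (arcs-∪-≤ A (flip A)) ⟩
    arcs F₀ + (arcs A + arcs (flip A))          ≡⟨ cong₂ (λ x y → x + (y + arcs (flip A))) (arcs≡2*numEdges F₀ F₀-graph) (arcs-flip A) ⟩
    2 * numEdges F₀ + (arcs (flip A) + arcs (flip A)) ≤⟨ +-monoʳ-≤ (2 * numEdges F₀) (+-mono-≤ arcs-Aᵀ≤uncovered arcs-Aᵀ≤uncovered) ⟩
    2 * numEdges F₀ + (c + c)                   ≡⟨ cong (λ m → 2 * numEdges F₀ + (c + m)) (sym (+-identityʳ c)) ⟩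
    2 * numEdges F₀ + 2 * c                     ≡⟨ sym (*-distribˡ-+ 2 (numEdges F₀) c) ⟩
    2 * (numEdges F₀ + c)                       ∎)
    where
    open ≤-Reasoning
    c = count (uncovered H F₀ S)

rho≤edges+uncovered : ∀ {n} {H F₀ : Rel n} {S r} → IsGraph H → IsGraph F₀ → F₀ ⊆ᴱ H →
  Rho H S r → r ≤ numEdges F₀ + count (isolatedB F₀ S)
rho≤edges+uncovered {n} {H} {F₀} {S} {r} H-graph F₀-graph F₀⊆H (_ , minimal)
  with extend-cover S H-graph F₀-graph F₀⊆H
... | F , covers , F-size = begin
  r                                                                ≤⟨ minimal F covers ⟩
  numEdges F + count (isolatedB H S)                               ≤⟨ +-monoˡ-≤ _ F-size ⟩
  numEdges F₀ + count (uncovered H F₀ S) + count (isolatedB H S)   ≡⟨ +-assoc (numEdges F₀) _ _ ⟩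
  numEdges F₀ + (count (uncovered H F₀ S) + count (isolatedB H S)) ≤⟨ +-monoʳ-≤ (numEdges F₀) (count-+-≤ _ _ _ pointwise) ⟩
  numEdges F₀ + count (isolatedB F₀ S)                             ∎
  where
  open ≤-Reasoning
  pointwise : ∀ v → ind (uncovered H F₀ S v) + ind (isolatedB H S v) ≤ ind (isolatedB F₀ S v)
  pointwise v with isolatedB H S v in isoH
  ... | true rewrite isolated-antimono {S = S} v F₀⊆H isoH = ≤-refl
  ... | false rewrite ∧-identityʳ (isolatedB F₀ S v) | +-identityʳ (ind (isolatedB F₀ S v)) = ≤-refl

-- Edges inside and leaving a vertex set

induced : ∀ {n} → Rel n → (Fin n → Bool) → Rel n
induced E S u v = S u ∧ (S v ∧ E u v)

boundary : ∀ {n} → Rel n → (Fin n → Bool) → Rel n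
boundary E S u v = S u ∧ (not (S v) ∧ E u v)

induced-isGraph : ∀ {n} {E : Rel n} (S : Fin n → Bool) → IsGraph E → IsGraph (induced E S)
induced-isGraph {E = E} S (E-sym , E-irr) = induced-sym , induced-irr
  where
  induced-sym : ∀ u v → induced E S u v ≡ induced E S v u
  induced-sym u v rewrite E-sym u v with S u | S v
  ... | true | true = refl
  ... | true | false = refl
  ... | false | true = refl
  ... | false | false = refl
  induced-irr : ∀ v → induced E S v v ≡ false
  induced-irr v rewrite E-irr v with S v
  ... | true = refl
  ... | false = refl

coInduced-isGraph : ∀ {n} (G : Rel n) (S : Fin n → Bool) → IsGraph (coInduced G S)
coInduced-isGraph G S = coInduced-sym , coInduced-irr
  where
  swap : ∀ a b c d e → a ∧ (b ∧ (c ∧ (d ∧ e))) ≡ b ∧ (a ∧ (d ∧ (c ∧ e)))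
  swap true true true true e = refl
  swap true true true false e = refl
  swap true true false true e = refl
  swap true true false false e = refl
  swap true false c d e = refl
  swap false true c d e = refl
  swap false false c d e = refl
  coInduced-sym : ∀ u v → coInduced G S u v ≡ coInduced G S v u
  coInduced-sym u v rewrite ≡ᵇ-sym (toℕ u) (toℕ v) = swap (S u) (S v) (not (G u v)) (not (G v u)) _
  coInduced-irr : ∀ v → coInduced G S v v ≡ false
  coInduced-irr v rewrite ≡ᵇ-refl (toℕ v) | ∧-zeroʳ (not (G v v)) | ∧-zeroʳ (not (G v v)) | ∧-zeroʳ (S v) = ∧-zeroʳ (S v)

edge⇒distinct : ∀ {n} {E : Rel n} {u v} → (∀ w → E w w ≡ false) → E u v ≡ true → (u == v) ≡ false
edge⇒distinct {E = E} {u} E-irr Euv =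
  ≢true⇒false (λ u=v → t≢f (trans (sym Euv) (subst (λ w → E u w ≡ false) (==⇒≡ u=v) (E-irr u))))

induced⊆coInduced : ∀ {n} {G E : Rel n} (S : Fin n → Bool) → IsGraph E →
  (∀ u v → E u v ≡ true → G u v ≡ false) → induced E S ⊆ᴱ coInduced G S
induced⊆coInduced {E = E} S (E-sym , E-irr) E∩G=∅ u v e with ∧-true⁻ {S u} e
... | Su , rest with ∧-true⁻ {S v} rest
...   | Sv , Euv
  rewrite Su | Sv | E∩G=∅ u v Euv | E∩G=∅ v u (trans (E-sym v u) Euv) | edge⇒distinct {E = E} {u} {v} E-irr Euv = refl

isolated≤boundary : ∀ {n} {E : Rel n} (S : Fin n → Bool) → IsGraph E →
  (∀ v → S v ≡ true → ∃ λ u → E v u ≡ true) → count (isolatedB (induced E S) S) ≤ arcs (boundary E S)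
isolated≤boundary {E = E} S (E-sym , _) has-edge = count-≤-arcs _ (boundary E S) leaves
  where
  leaves : ∀ v → isolatedB (induced E S) S v ≡ true → ∃ λ u → boundary E S v u ≡ true
  leaves v iso with ∧-true⁻ iso
  ... | Sv , none with has-edge v Sv
  ...   | u , Evu = u , ∧-true⁺ Sv (∧-true⁺ (cong not Su≡false) Evu)
    where
    Su≡false : S u ≡ false
    Su≡false = ≢true⇒false (λ Su → t≢f (trans (sym (∧-true⁺ Su (∧-true⁺ Sv (trans (E-sym u v) Evu))))
                                              (not-injective (allB-true⁻ none u))))

numEdges-induced+arcs-boundary≤ : ∀ {n} {E : Rel n} (S : Fin n → Bool) → IsGraph E →
  numEdges (induced E S) + arcs (boundary E S) ≤ numEdges E
numEdges-induced+arcs-boundary≤ {n} {E} S E-graph@(E-sym , _) = *-cancelˡ-≤ 2 (begin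
  2 * (numEdges I + arcs B)           ≡⟨ *-distribˡ-+ 2 (numEdges I) (arcs B) ⟩
  2 * numEdges I + 2 * arcs B         ≡⟨ cong₂ _+_ (sym (arcs≡2*numEdges I (induced-isGraph S E-graph)))
                                                   (cong (arcs B +_) (+-identityʳ (arcs B))) ⟩
  arcs I + (arcs B + arcs B)          ≡⟨ cong (λ m → arcs I + (arcs B + m)) (arcs-flip B) ⟩
  arcs I + (arcs B + arcs (flip B))   ≡⟨ sym (+-assoc (arcs I) (arcs B) (arcs (flip B))) ⟩
  arcs I + arcs B + arcs (flip B)     ≤⟨ +-monoˡ-≤ (arcs (flip B)) (arcs-+-≤ I B out-of-S inside+leaving) ⟩
  arcs out-of-S + arcs (flip B)       ≤⟨ arcs-+-≤ out-of-S (flip B) E out-of-S+entering ⟩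
  arcs E                              ≡⟨ arcs≡2*numEdges E E-graph ⟩
  2 * numEdges E                      ∎)
  where
  open ≤-Reasoning
  I = induced E S
  B = boundary E S
  out-of-S : Rel n
  out-of-S u v = S u ∧ E u v
  inside+leaving : ∀ u v → ind (I u v) + ind (B u v) ≤ ind (out-of-S u v)
  inside+leaving u v with S u | S v
  ... | true | true = ≤-reflexive (+-identityʳ (ind (E u v)))
  ... | true | false = ≤-refl
  ... | false | _ = ≤-refl
  out-of-S+entering : ∀ u v → ind (out-of-S u v) + ind (B v u) ≤ ind (E u v)
  out-of-S+entering u v rewrite E-sym v u with S u | S v
  ... | true | true = ≤-reflexive (+-identityʳ (ind (E u v)))
  ... | true | false = ≤-reflexive (+-identityʳ (ind (E u v)))
  ... | false | true = ≤-refl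
  ... | false | false = z≤n

lemma7 : (n : ℕ) (G : Rel n) → IsGraph G → Cograph G →
    (k : ℕ) → EdgeConnectivity G k →
    (Eca : Rel n) → IsGraph Eca → (∀ u v → Eca u v ≡ true → G u v ≡ false) →
    EdgeConnectivity (G ∪ᴱ Eca) (suc k) →
    (r : ℕ) → Rho (coInduced G (λ v → deg G v ≡ᵇ k)) (λ v → deg G v ≡ᵇ k) r →
    r ≤ numEdges Eca
lemma7 n G G-graph _ k _ Eca Eca-graph Eca-new κ r ρ = begin
  r                                                     ≤⟨ rho≤edges+uncovered (coInduced-isGraph G X) (induced-isGraph X Eca-graph)
                                                                                (induced⊆coInduced X Eca-graph Eca-new) ρ ⟩
  numEdges (induced Eca X) + count (isolatedB (induced Eca X) X) ≤⟨ +-monoʳ-≤ _ (isolated≤boundary X Eca-graph gains-edge) ⟩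
  numEdges (induced Eca X) + arcs (boundary Eca X)      ≤⟨ numEdges-induced+arcs-boundary≤ X Eca-graph ⟩
  numEdges Eca                                          ∎
  where
  open ≤-Reasoning
  X : Fin n → Bool
  X v = deg G v ≡ᵇ k
  gains-edge : ∀ v → X v ≡ true → ∃ λ u → Eca v u ≡ true
  gains-edge v Xv = new-neighbour G-graph Eca-graph κ v (≡ᵇ-true⇒≡ (deg G v) k Xv)
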